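{- Let $1\le v\le n$, $E=\{0,1,\dots,n-1\}$, $A\subseteq E$ with $|A|=k$, $A^c=E\setminus A$, and $R=\min(v,n-k,k,n-v)$. Then for every integer $r$, $S_r(A)=S_{R-r}(A^c)$ as subsets of $J(n,v)$.
   Context: $J(n,v)$ denotes the set of all $v$-element subsets of $E$ (vertices of the Johnson graph). For $A\subseteq E$ and an integer $r$, the shell $S_r(A)=\{L\in J(n,v):\min(|L\setminus A|,|A\setminus L|)=r\}$ (empty if no such $L$ exists, e.g. for $r<0$). -}

module Defs where

open import Data.Nat using (ℕ; _⊓_; _∸_)
open import Data.Integer using (ℤ; +_)
open import Data.Fin.Subset using (Subset; ∣_∣; _─_)
open import Relation.Binary.PropositionalEquality using (_≡_)
open import Data.Product using (_×_)

-- Subsets of E = {0,…,n-1} are  Subset n  (= Vec Bool n).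
-- Membership of L in J(n,v): L is a v-element subset of E.
InJ : (n v : ℕ) → Subset n → Set
InJ n v L = ∣ L ∣ ≡ v

InShell : (n v : ℕ) → ℤ → Subset n → Subset n → Set
InShell n v r A L = InJ n v L × (+ (∣ L ─ A ∣ ⊓ ∣ A ─ L ∣) ≡ r)

Rval : (n v : ℕ) → Subset n → ℕ
Rval n v A = v ⊓ (n ∸ ∣ A ∣) ⊓ ∣ A ∣ ⊓ (n ∸ v)

-- With a = |L \ A|, b = |A \ L|, c = |L ∩ A| and d = |E \ (L ∪ A)| we have
-- |L| = a + c, |A| = b + c, n - |A| = a + d and n - |L| = b + d, so that
-- R = min(a + c, a + d, b + c, b + d) = min(a, b) + min(c, d).  Since the
-- shell index of L with respect to A is min(a, b) and with respect to A^c is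
-- min(c, d), the two indices always add up to R.
module Submission where

open import Defs
open import Data.Nat using (ℕ; _≤_)
open import Data.Integer using (ℤ; +_; _-_)
open import Data.Fin.Subset using (Subset; ∁)
open import Function.Bundles using (_⇔_)

open import Data.Bool using (true; false)
open import Data.Vec using ([]; _∷_)
open import Data.Nat using (suc; _+_; _⊓_)
open import Data.Nat.Properties using (+-suc; +-comm; +-distribˡ-⊓; +-distribʳ-⊓; ⊓-assoc)
import Data.Integer as ℤ
import Data.Integer.Properties as ℤP
open import Data.Integer.Tactic.RingSolver using (solve-∀)
open import Data.Fin.Subset using (∣_∣; _─_)
open import Data.Fin.Subset.Properties using (∣∁p∣≡n∸∣p∣)
open import Data.Product using (_,_)
open import Function.Bundles using (mk⇔; Equivalence)
open import Relation.Binary.PropositionalEquality using (_≡_; refl; sym; trans; cong; cong₂; module ≡-Reasoning)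

private
  variable
    n : ℕ

∁-involutive : (p : Subset n) → ∁ (∁ p) ≡ p
∁-involutive []          = refl
∁-involutive (true ∷ p)  = cong (true ∷_) (∁-involutive p)
∁-involutive (false ∷ p) = cong (false ∷_) (∁-involutive p)

p─q≡∁q─∁p : (p q : Subset n) → p ─ q ≡ ∁ q ─ ∁ p
p─q≡∁q─∁p []          []          = refl
p─q≡∁q─∁p (true ∷ p)  (true ∷ q)  = cong (false ∷_) (p─q≡∁q─∁p p q)
p─q≡∁q─∁p (false ∷ p) (true ∷ q)  = cong (false ∷_) (p─q≡∁q─∁p p q)
p─q≡∁q─∁p (true ∷ p)  (false ∷ q) = cong (true ∷_) (p─q≡∁q─∁p p q)
p─q≡∁q─∁p (false ∷ p) (false ∷ q) = cong (false ∷_) (p─q≡∁q─∁p p q)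

p─∁q≡q─∁p : (p q : Subset n) → p ─ ∁ q ≡ q ─ ∁ p
p─∁q≡q─∁p p q = trans (p─q≡∁q─∁p p (∁ q)) (cong (_─ ∁ p) (∁-involutive q))

∁p─q≡∁q─p : (p q : Subset n) → ∁ p ─ q ≡ ∁ q ─ p
∁p─q≡∁q─p p q = trans (p─q≡∁q─∁p (∁ p) q) (cong (∁ q ─_) (∁-involutive p))

∣p∣≡∣p─q∣+∣p─∁q∣ : (p q : Subset n) → ∣ p ∣ ≡ ∣ p ─ q ∣ + ∣ p ─ ∁ q ∣
∣p∣≡∣p─q∣+∣p─∁q∣ []          []          = refl
∣p∣≡∣p─q∣+∣p─∁q∣ (true ∷ p)  (true ∷ q)  =
  trans (cong suc (∣p∣≡∣p─q∣+∣p─∁q∣ p q)) (sym (+-suc ∣ p ─ q ∣ ∣ p ─ ∁ q ∣))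
∣p∣≡∣p─q∣+∣p─∁q∣ (true ∷ p)  (false ∷ q) = cong suc (∣p∣≡∣p─q∣+∣p─∁q∣ p q)
∣p∣≡∣p─q∣+∣p─∁q∣ (false ∷ p) (true ∷ q)  = ∣p∣≡∣p─q∣+∣p─∁q∣ p q
∣p∣≡∣p─q∣+∣p─∁q∣ (false ∷ p) (false ∷ q) = ∣p∣≡∣p─q∣+∣p─∁q∣ p q

[m⊓n]+[o⊓p]≡[m+o]⊓[m+p]⊓[n+o]⊓[n+p] : ∀ m n o p →
  (m ⊓ n) + (o ⊓ p) ≡ (m + o) ⊓ (m + p) ⊓ (n + o) ⊓ (n + p)
[m⊓n]+[o⊓p]≡[m+o]⊓[m+p]⊓[n+o]⊓[n+p] m n o p = begin
  (m ⊓ n) + (o ⊓ p)                         ≡⟨ +-distribʳ-⊓ (o ⊓ p) m n ⟩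
  (m + (o ⊓ p)) ⊓ (n + (o ⊓ p))             ≡⟨ cong₂ _⊓_ (+-distribˡ-⊓ m o p) (+-distribˡ-⊓ n o p) ⟩
  ((m + o) ⊓ (m + p)) ⊓ ((n + o) ⊓ (n + p)) ≡⟨ sym (⊓-assoc ((m + o) ⊓ (m + p)) (n + o) (n + p)) ⟩
  (m + o) ⊓ (m + p) ⊓ (n + o) ⊓ (n + p)     ∎
  where open ≡-Reasoning

shellIndex : Subset n → Subset n → ℕ
shellIndex A L = ∣ L ─ A ∣ ⊓ ∣ A ─ L ∣

shellIndex+shellIndex∁≡Rval : (A L : Subset n) →
  shellIndex A L + shellIndex (∁ A) L ≡ Rval n ∣ L ∣ A
shellIndex+shellIndex∁≡Rval {n} A L = begin
  (a ⊓ b) + (c ⊓ d)                     ≡⟨ [m⊓n]+[o⊓p]≡[m+o]⊓[m+p]⊓[n+o]⊓[n+p] a b c d ⟩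
  (a + c) ⊓ (a + d) ⊓ (b + c) ⊓ (b + d) ≡⟨ sym (cong₂ _⊓_ (cong₂ _⊓_ (cong₂ _⊓_ ∣L∣ ∣∁A∣) ∣A∣) ∣∁L∣) ⟩
  ∣ L ∣ ⊓ ∣ ∁ A ∣ ⊓ ∣ A ∣ ⊓ ∣ ∁ L ∣     ≡⟨ cong₂ (λ x y → ∣ L ∣ ⊓ x ⊓ ∣ A ∣ ⊓ y) (∣∁p∣≡n∸∣p∣ A) (∣∁p∣≡n∸∣p∣ L) ⟩
  Rval n ∣ L ∣ A                        ∎
  where
  open ≡-Reasoning
  a = ∣ L ─ A ∣
  b = ∣ A ─ L ∣
  c = ∣ L ─ ∁ A ∣
  d = ∣ ∁ A ─ L ∣
  ∣L∣ : ∣ L ∣ ≡ a + c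
  ∣L∣ = ∣p∣≡∣p─q∣+∣p─∁q∣ L A
  ∣A∣ : ∣ A ∣ ≡ b + c
  ∣A∣ = trans (∣p∣≡∣p─q∣+∣p─∁q∣ A L) (cong (λ s → b + ∣ s ∣) (p─∁q≡q─∁p A L))
  ∣∁A∣ : ∣ ∁ A ∣ ≡ a + d
  ∣∁A∣ = trans (∣p∣≡∣p─q∣+∣p─∁q∣ (∁ A) L)
               (trans (cong (λ s → d + ∣ s ∣) (sym (p─q≡∁q─∁p L A))) (+-comm d a))
  ∣∁L∣ : ∣ ∁ L ∣ ≡ b + d
  ∣∁L∣ = trans (∣p∣≡∣p─q∣+∣p─∁q∣ (∁ L) A)
               (trans (cong₂ (λ s t → ∣ s ∣ + ∣ t ∣) (∁p─q≡∁q─p L A) (sym (p─q≡∁q─∁p A L)))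
                      (+-comm d b))

j≡[i+j]-i : ∀ i j → j ≡ (i ℤ.+ j) - i
j≡[i+j]-i = solve-∀

i-[i-j]≡j : ∀ i j → i - (i - j) ≡ j
i-[i-j]≡j = solve-∀

i+j≡k⇒i≡r⇒j≡k-r : ∀ {i j k r} → i ℤ.+ j ≡ k → i ≡ r → j ≡ k - r
i+j≡k⇒i≡r⇒j≡k-r {i} {j} refl refl = j≡[i+j]-i i j

i+j≡k⇒[i≡r⇔j≡k-r] : ∀ {i j k} r → i ℤ.+ j ≡ k → (i ≡ r) ⇔ (j ≡ k - r)
i+j≡k⇒[i≡r⇔j≡k-r] {i} {j} {k} r i+j≡k = mk⇔
  (i+j≡k⇒i≡r⇒j≡k-r i+j≡k)
  (λ j≡k-r → trans (i+j≡k⇒i≡r⇒j≡k-r (trans (ℤP.+-comm j i) i+j≡k) j≡k-r) (i-[i-j]≡j k r))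

lemma8 : (n v : ℕ) → 1 ≤ v → v ≤ n → (A : Subset n) → (r : ℤ) →
    (L : Subset n) →
    InShell n v r A L ⇔ InShell n v ((+ Rval n v A) - r) (∁ A) L
lemma8 n v _ _ A r L = mk⇔
  (λ (L∈J , e) → L∈J , Equivalence.to   (shellIndices L∈J) e)
  (λ (L∈J , e) → L∈J , Equivalence.from (shellIndices L∈J) e)
  where
  shellIndices : InJ n v L → (+ shellIndex A L ≡ r) ⇔ (+ shellIndex (∁ A) L ≡ + Rval n v A - r)
  shellIndices refl = i+j≡k⇒[i≡r⇔j≡k-r] r
    (trans (sym (ℤP.pos-+ (shellIndex A L) (shellIndex (∁ A) L)))
           (cong +_ (shellIndex+shellIndex∁≡Rval A L)))
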